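{- Consider stream interval predicates over vectors of real functions. Each of the following four inequalities fails for suitable choices of $n$, $F,G,H,K:S_1\to S_2\to\mathbb{B}$ (with $S_2=(\mathbb{R}^n)^{\mathbb{R}}$): (a) $F\cdot G\le F\ast G$; (b) $(F\ast G)\cdot H\le F\ast(G\cdot H)$; (c) $F\cdot(G\ast H)\le (F\cdot G)\ast H$; (d) $(F\ast G)\cdot(H\ast K)\le (F\cdot H)\ast(G\cdot K)$.
   Context: $S_1$ is the set of non-empty closed intervals $[a,b]$ ($a\le b$) of real numbers with partial fusion product $[a,b]\cdot[c,d]=[a,d]$ if $b=c$ and undefined otherwise. On $\mathbb{R}^n$ define the partial commutative operation $\ast$ componentwise: $(u\ast v)_i=u_i$ if $v_i=0$, $=v_i$ if $u_i=0$, and undefined otherwise; $u\ast v$ is undefined if some component is undefined. $S_2$ is the set of functions $f:\mathbb{R}\to\mathbb{R}^n$ with pointwise partial operation $(f\ast g)(t)=f(t)\ast g(t)$ (defined iff defined for every $t$). $\mathbb{B}=\{0,1\}$ with $0\le 1$. For $F,G:S_1\to S_2\to\mathbb{B}$: $F\le G$ iff $F\,x\,f\le G\,x\,f$ for all $x,f$; $(F\cdot G)\,x\,f=\bigvee_{x=y\cdot z}(F\,y\,f\wedge G\,z\,f)$ over decompositions of the interval $x$; $(F\ast G)\,x\,f=\bigvee_{f=g\ast h}(F\,x\,g\wedge G\,x\,h)$ over decompositions of $f$. -}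

module Defs where

open import Data.Bool using (Bool; true)
open import Data.Nat using (ℕ)
open import Data.Fin using (Fin)
open import Data.Product using (Σ; ∃; _×_; _,_)
open import Data.Sum using (_⊎_)
open import Relation.Binary.PropositionalEquality using (_≡_; _≢_)
open import Algebra.Structures using (IsCommutativeRing)
open import Relation.Binary.Structures using (IsTotalOrder)

-- The real numbers, given axiomatically as a complete ordered field
-- (the stdlib has no reals; any model of these axioms is ≅ ℝ).
record RealNumbers : Set₁ where
  infixl 6 _+_
  infixl 7 _*_
  infix 4 _≤_
  field
    ℝ : Set
    _+_ _*_ : ℝ → ℝ → ℝ
    -_ : ℝ → ℝ
    0ℝ 1ℝ : ℝ
    _≤_ : ℝ → ℝ → Set
    isCommutativeRing : IsCommutativeRing _≡_ _+_ _*_ -_ 0ℝ 1ℝ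
    0≢1 : 0ℝ ≢ 1ℝ
    inverse : ∀ x → x ≢ 0ℝ → Σ ℝ λ y → x * y ≡ 1ℝ
    isTotalOrder : IsTotalOrder _≡_ _≤_
    +-monoˡ-≤ : ∀ {x y} z → x ≤ y → x + z ≤ y + z
    *-nonneg : ∀ {x y} → 0ℝ ≤ x → 0ℝ ≤ y → 0ℝ ≤ x * y
    lub : ∀ (P : ℝ → Set) → Σ ℝ P → Σ ℝ (λ b → ∀ x → P x → x ≤ b) →
          Σ ℝ λ s → (∀ x → P x → x ≤ s) × (∀ b → (∀ x → P x → x ≤ b) → s ≤ b)

module _ (R : RealNumbers) where
  open RealNumbers R

  -- S₁ : non-empty closed intervals [lo , hi] with lo ≤ hi
  record Interval : Set where
    constructor [_,_]⟨_⟩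
    field
      lo hi : ℝ
      lo≤hi : lo ≤ hi

  -- x ≡ y · z  (fusion product: [a,b]·[b,d] = [a,d])
  IsFusion : Interval → Interval → Interval → Set
  IsFusion x y z = Interval.lo y ≡ Interval.lo x
                 × Interval.hi y ≡ Interval.lo z
                 × Interval.hi z ≡ Interval.hi x

  S₂ : ℕ → Set
  S₂ n = ℝ → Fin n → ℝ

  -- c = a ∗ b on ℝ (defined iff a = 0 or b = 0)
  IsStarℝ : ℝ → ℝ → ℝ → Set
  IsStarℝ c a b = (b ≡ 0ℝ × c ≡ a) ⊎ (a ≡ 0ℝ × c ≡ b)

  IsStar : ∀ {n} → S₂ n → S₂ n → S₂ n → Set
  IsStar f g h = ∀ t i → IsStarℝ (f t i) (g t i) (h t i)

  BPred : ℕ → Set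
  BPred n = Interval → S₂ n → Bool

-- Truth of composite 𝔹-valued predicates, with ⋁ read as existence
-- and ∧ as ×.  Wrapped in a record so that R and n are inferable.
record Pred (R : RealNumbers) (n : ℕ) : Set₁ where
  constructor mkPred
  field holds : Interval R → S₂ R n → Set
open Pred public

module _ {R : RealNumbers} {n : ℕ} where

  ⟦_⟧ : BPred R n → Pred R n
  ⟦ F ⟧ = mkPred λ x f → F x f ≡ true

  infixl 7 _·_
  infixl 6 _∗_
  infix 4 _≤ₚ_

  _·_ : Pred R n → Pred R n → Pred R n
  F · G = mkPred λ x f → Σ (Interval R) λ y → Σ (Interval R) λ z →
            IsFusion R x y z × holds F y f × holds G z f

  _∗_ : Pred R n → Pred R n → Pred R n
  F ∗ G = mkPred λ x f → Σ (S₂ R n) λ g → Σ (S₂ R n) λ h →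
            IsStar R f g h × holds F x g × holds G x h

  _≤ₚ_ : Pred R n → Pred R n → Set
  F ≤ₚ G = ∀ x f → holds F x f → holds G x f

module Submission where

-- All four counterexamples live in dimension n = 1 and use a
-- single interesting predicate: P x f = "f(0) ≠ 0", which ignores its
-- interval, together with the always-true predicate T.  Since u ∗ v on ℝ
-- is only defined when u = 0 or v = 0, no function can be split as g ∗ h
-- with both g(0) and h(0) non-zero; hence P ∗ P is empty.  On the other
-- hand, on the point interval [0,0] (which is its own fusion [0,0]·[0,0])
-- with the constant function 1, every left-hand side holds, because P, T ∗ P
-- and P ∗ T hold there (split 1 = 0 ∗ 1 = 1 ∗ 0) and so do their fusions.

open import Defs
open import Data.Nat using (ℕ)
open import Data.Product using (Σ; _×_; _,_)
open import Data.Sum using (_⊎_; inj₁; inj₂; [_,_]′)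
open import Data.Bool using (Bool; true; false; _xor_)
open import Data.Bool.Properties using (xor-same)
open import Data.Fin using (Fin; zero)
open import Data.Empty using (⊥-elim)
open import Function using (const)
open import Relation.Nullary using (¬_)
open import Relation.Binary.PropositionalEquality
  using (_≡_; _≢_; refl; sym; trans)
open import Relation.Binary.Structures using (IsTotalOrder)

module PredicateAlgebra (R : RealNumbers) where
  private variable n : ℕ

  open RealNumbers R using (ℝ; 0ℝ; isTotalOrder)
  open IsTotalOrder isTotalOrder using () renaming (refl to ≤-refl)

  ≤ₚ-refl : {F : Pred R n} → F ≤ₚ F
  ≤ₚ-refl _ _ Fxf = Fxf

  ∗-mono : {F F′ G G′ : Pred R n} → F ≤ₚ F′ → G ≤ₚ G′ → F ∗ G ≤ₚ F′ ∗ G′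
  ∗-mono F≤F′ G≤G′ x f (g , h , f=g∗h , Fg , Gh) =
    g , h , f=g∗h , F≤F′ x g Fg , G≤G′ x h Gh

  IntervalFree : Pred R n → Set
  IntervalFree F = ∀ x y f → holds F y f → holds F x f

  ·-absorbˡ : {F G : Pred R n} → IntervalFree F → F · G ≤ₚ F
  ·-absorbˡ free x f (y , z , _ , Fy , _) = free x y f Fy

  ·-absorbʳ : {F G : Pred R n} → IntervalFree G → F · G ≤ₚ G
  ·-absorbʳ free x f (y , z , _ , _ , Gz) = free x z f Gz

  -- The degenerate interval [a,a], which is its own fusion [a,a]·[a,a];
  -- hence F · G holds there as soon as both F and G do.
  point : ℝ → Interval R
  point a = [ a , a ]⟨ ≤-refl ⟩

  ·-intro-point : (F G : Pred R n) {a : ℝ} {f : S₂ R n} →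
                  holds F (point a) f → holds G (point a) f →
                  holds (F · G) (point a) f
  ·-intro-point F G {a} Ff Gf = point a , point a , (refl , refl , refl) , Ff , Gf

  zeroFn : S₂ R n
  zeroFn _ _ = 0ℝ

  -- f = f ∗ 0 and f = 0 ∗ f, so a predicate holding at the zero function
  -- can be attached to either side of any predicate by ∗.
  ∗-introʳ : (F G : Pred R n) {x : Interval R} {f : S₂ R n} →
             holds F x f → holds G x zeroFn → holds (F ∗ G) x f
  ∗-introʳ F G {f = f} Ff G0 = f , zeroFn , (λ t i → inj₁ (refl , refl)) , Ff , G0

  ∗-introˡ : (F G : Pred R n) {x : Interval R} {f : S₂ R n} →
             holds F x zeroFn → holds G x f → holds (F ∗ G) x f
  ∗-introˡ F G {f = f} F0 Gf = zeroFn , f , (λ t i → inj₂ (refl , refl)) , F0 , Gf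

module Counterexamples (R : RealNumbers) where
  open RealNumbers R
  open IsTotalOrder isTotalOrder using (total; antisym)
  open PredicateAlgebra R

  isLeft : {A B : Set} → A ⊎ B → Bool
  isLeft = [ const true , const false ]′

  -- "a ≠ 0" as a Boolean: a is non-zero exactly when the two totality
  -- witnesses for a versus 0 point in different directions.
  nonzero : ℝ → Bool
  nonzero a = isLeft (total a 0ℝ) xor isLeft (total 0ℝ a)

  nonzero-0 : nonzero 0ℝ ≡ false
  nonzero-0 = xor-same (isLeft (total 0ℝ 0ℝ))

  -- If both witnesses point the same way, antisymmetry forces a = 0.
  nonzero-≢0 : ∀ {a} → a ≢ 0ℝ → nonzero a ≡ true
  nonzero-≢0 {a} a≢0 with total a 0ℝ | total 0ℝ a
  ... | inj₁ a≤0 | inj₁ 0≤a = ⊥-elim (a≢0 (antisym a≤0 0≤a))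
  ... | inj₁ _   | inj₂ _   = refl
  ... | inj₂ _   | inj₁ _   = refl
  ... | inj₂ 0≤a | inj₂ a≤0 = ⊥-elim (a≢0 (antisym a≤0 0≤a))

  nonzero⇒≢0 : ∀ {a} → nonzero a ≡ true → a ≢ 0ℝ
  nonzero⇒≢0 nz refl with trans (sym nonzero-0) nz
  ... | ()

  nonzeroAt : {n : ℕ} → ℝ → Fin n → BPred R n
  nonzeroAt t i _ f = nonzero (f t i)

  nonzeroAt-intervalFree : {n : ℕ} (t : ℝ) (i : Fin n) →
                           IntervalFree ⟦ nonzeroAt t i ⟧
  nonzeroAt-intervalFree t i x y f nz = nz

  -- Since u ∗ v on ℝ needs u = 0 or v = 0, no split f = g ∗ h has both
  -- g t i and h t i non-zero: the predicate nonzeroAt t i ∗ itself is empty.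
  nonzeroAt-∗-empty : {n : ℕ} (t : ℝ) (i : Fin n) → ∀ x f →
                      ¬ holds (⟦ nonzeroAt t i ⟧ ∗ ⟦ nonzeroAt t i ⟧) x f
  nonzeroAt-∗-empty t i x f (g , h , f=g∗h , g≠0 , h≠0) with f=g∗h t i
  ... | inj₁ (h≡0 , _) = nonzero⇒≢0 h≠0 h≡0
  ... | inj₂ (g≡0 , _) = nonzero⇒≢0 g≠0 g≡0

  P T : BPred R 1
  P = nonzeroAt 0ℝ zero
  T _ _ = true

  [0,0] : Interval R
  [0,0] = point 0ℝ

  one : S₂ R 1
  one _ _ = 1ℝ

  P-one : holds ⟦ P ⟧ [0,0] one
  P-one = nonzero-≢0 {1ℝ} (λ 1≡0 → 0≢1 (sym 1≡0))

  T-zero : holds ⟦ T ⟧ [0,0] zeroFn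
  T-zero = refl

  P∗P-fails : ¬ holds (⟦ P ⟧ ∗ ⟦ P ⟧) [0,0] one
  P∗P-fails = nonzeroAt-∗-empty 0ℝ zero [0,0] one

  P-free : IntervalFree ⟦ P ⟧
  P-free = nonzeroAt-intervalFree 0ℝ zero

  refute : {A B : Pred R 1} → holds A [0,0] one → B ≤ₚ ⟦ P ⟧ ∗ ⟦ P ⟧ →
           ¬ (A ≤ₚ B)
  refute A-holds B≤P∗P A≤B = P∗P-fails (B≤P∗P [0,0] one (A≤B [0,0] one A-holds))

  P∗T-one : holds (⟦ P ⟧ ∗ ⟦ T ⟧) [0,0] one
  P∗T-one = ∗-introʳ ⟦ P ⟧ ⟦ T ⟧ {[0,0]} {one} P-one T-zero

  T∗P-one : holds (⟦ T ⟧ ∗ ⟦ P ⟧) [0,0] one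
  T∗P-one = ∗-introˡ ⟦ T ⟧ ⟦ P ⟧ {[0,0]} {one} T-zero P-one

-- Each left-hand side holds at ([0,0], 1) by the introduction rules, while
-- each right-hand side lies below P ∗ P since P absorbs fusion with T.
proposition13p2 : (R : RealNumbers) →
    (Σ ℕ λ n → Σ (BPred R n) λ F → Σ (BPred R n) λ G →
       ¬ (⟦ F ⟧ · ⟦ G ⟧ ≤ₚ ⟦ F ⟧ ∗ ⟦ G ⟧))
    × (Σ ℕ λ n → Σ (BPred R n) λ F → Σ (BPred R n) λ G → Σ (BPred R n) λ H →
       ¬ ((⟦ F ⟧ ∗ ⟦ G ⟧) · ⟦ H ⟧ ≤ₚ ⟦ F ⟧ ∗ (⟦ G ⟧ · ⟦ H ⟧)))
    × (Σ ℕ λ n → Σ (BPred R n) λ F → Σ (BPred R n) λ G → Σ (BPred R n) λ H →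
       ¬ (⟦ F ⟧ · (⟦ G ⟧ ∗ ⟦ H ⟧) ≤ₚ (⟦ F ⟧ · ⟦ G ⟧) ∗ ⟦ H ⟧))
    × (Σ ℕ λ n → Σ (BPred R n) λ F → Σ (BPred R n) λ G → Σ (BPred R n) λ H →
       Σ (BPred R n) λ K →
       ¬ ((⟦ F ⟧ ∗ ⟦ G ⟧) · (⟦ H ⟧ ∗ ⟦ K ⟧) ≤ₚ (⟦ F ⟧ · ⟦ H ⟧) ∗ (⟦ G ⟧ · ⟦ K ⟧)))
proposition13p2 R =
    (1 , P , P ,
       refute (·-intro-point ⟦ P ⟧ ⟦ P ⟧ {f = one} P-one P-one) ≤ₚ-refl)
  , (1 , P , T , P ,
       refute (·-intro-point (⟦ P ⟧ ∗ ⟦ T ⟧) ⟦ P ⟧ {f = one} P∗T-one P-one)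
              (∗-mono ≤ₚ-refl (·-absorbʳ P-free)))
  , (1 , P , T , P ,
       refute (·-intro-point ⟦ P ⟧ (⟦ T ⟧ ∗ ⟦ P ⟧) {f = one} P-one T∗P-one)
              (∗-mono (·-absorbˡ P-free) ≤ₚ-refl))
  , (1 , P , T , T , P ,
       refute (·-intro-point (⟦ P ⟧ ∗ ⟦ T ⟧) (⟦ T ⟧ ∗ ⟦ P ⟧) {f = one} P∗T-one T∗P-one)
              (∗-mono (·-absorbˡ P-free) (·-absorbʳ P-free)))
  where
    open Counterexamples R
    open PredicateAlgebra R
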